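{- Let $\mathbf{L}$ be a predicate modal logic that admits countably many pairs, each consisting of axiom schemata $\alpha\supset\beta_i$ ($i\in\omega$) and the $\omega$-rule $\frac{p\supset\beta_i\ (i\in\omega)}{p\supset\alpha}$, with $\alpha,\beta_i$ closed formulas. Then the Lindenbaum algebra $A(\mathbf{L})$ is a modal algebra in which, for each such pair and each uniform substitution $s$, $$[s(\alpha)]=\bigwedge_{i\in\omega}[s(\beta_i)],$$ and for every formula $\phi$ and every variable $x$, $$[\forall x\phi]=\bigwedge_{y\in\mathsf{V}}\big[[y/x]\phi\big].$$ Moreover, if $\mathbf{L}$ satisfies some of the properties $\mathrm{MT}$, $\mathrm{TP}$, $\mathrm{CF}$, then $A(\mathbf{L})$ satisfies the corresponding properties.
   Context: Language: countable set $\mathsf{V}$ of variables, $\top,\bot,\land,\neg,\forall$, countably many predicate symbols of each arity, and a modal operator $\Box$; $\lor,\supset,\equiv,\exists$ defined as usual; $[y/x]\phi$ is the result of substituting $y$ for the free occurrences of $x$ in $\phi$. A predicate modal logic is a set $\mathbf{L}$ of formulas containing all classical predicate tautologies, closed under modus ponens, uniform substitution of formulas for predicate symbols, generalization (if $\phi\in\mathbf{L}$ then $\forall x\phi\in\mathbf{L}$), and the congruence rule (if $\phi\equiv\psi\in\mathbf{L}$ then $\Box\phi\equiv\Box\psi\in\mathbf{L}$). $\mathbf{L}$ is MT, TP, CF if respectively $\Box(p\land q)\supset\Box p\land\Box q\in\mathbf{L}$, $\Box\top\in\mathbf{L}$, $\Box p\land\Box q\supset\Box(p\land q)\in\mathbf{L}$.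 $\mathbf{L}$ admits a pair (closed formulas $\alpha,\beta_i$, $i\in\omega$) if for every uniform substitution $s$: $s(\alpha\supset\beta_i)\in\mathbf{L}$ for all $i$, and for every formula $\phi$, if $\phi\supset s(\beta_i)\in\mathbf{L}$ for all $i$ then $\phi\supset s(\alpha)\in\mathbf{L}$. The Lindenbaum algebra $A(\mathbf{L})$ is the quotient of the set of formulas by $\phi\sim\psi\iff\phi\equiv\psi\in\mathbf{L}$, with Boolean operations induced by the connectives and $\Box[\phi]=[\Box\phi]$. A modal algebra is a Boolean algebra with a unary operator $\Box$; it is MT if $\Box(x\land y)\le\Box x\land\Box y$, TP if $\Box1=1$, CF if $\Box x\land\Box y\le\Box(x\land y)$. Infinite meets $\bigwedge$ are meets in the Boolean order (asserted to exist). -}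

module Defs where

open import Data.Nat using (ℕ; zero; suc; _≡ᵇ_; _⊔_)
open import Data.Bool using (Bool; true; false; if_then_else_)
open import Data.List using (List; []; _∷_; _++_; map; foldr; concatMap)
open import Data.Bool.ListAction using (any)
open import Data.Vec as Vec using (Vec; toList)
open import Data.Product using (Σ; _×_; _,_)
open import Relation.Binary.PropositionalEquality using (_≡_)
open import Data.List.Relation.Unary.Unique.Propositional using (Unique)
import Algebra.Lattice.Structures as LS

Var : Set
Var = ℕ

infixr 6 _∧ᶠ_
infixr 5 _∨ᶠ_
infixr 4 _⊃ᶠ_
infix  3 _≡ᶠ_

data Fm : Set where
  ⊤ᶠ ⊥ᶠ : Fm
  _∧ᶠ_  : Fm → Fm → Fm
  ¬ᶠ_   : Fm → Fm
  ∀ᶠ    : Var → Fm → Fm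
  pred  : (n k : ℕ) → Vec Var n → Fm
  □ᶠ    : Fm → Fm

_∨ᶠ_ : Fm → Fm → Fm
φ ∨ᶠ ψ = ¬ᶠ (¬ᶠ φ ∧ᶠ ¬ᶠ ψ)

_⊃ᶠ_ : Fm → Fm → Fm
φ ⊃ᶠ ψ = ¬ᶠ (φ ∧ᶠ ¬ᶠ ψ)

_≡ᶠ_ : Fm → Fm → Fm
φ ≡ᶠ ψ = (φ ⊃ᶠ ψ) ∧ᶠ (ψ ⊃ᶠ φ)

∃ᶠ : Var → Fm → Fm
∃ᶠ x φ = ¬ᶠ ∀ᶠ x (¬ᶠ φ)

elem : Var → List Var → Bool
elem v xs = any (λ u → u ≡ᵇ v) xs

removeV : Var → List Var → List Var
removeV v [] = []
removeV v (u ∷ us) = if u ≡ᵇ v then removeV v us else u ∷ removeV v us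

removeAll : List Var → List Var → List Var
removeAll [] xs = xs
removeAll (z ∷ zs) xs = removeAll zs (removeV z xs)

fv : Fm → List Var
fv ⊤ᶠ = []
fv ⊥ᶠ = []
fv (φ ∧ᶠ ψ) = fv φ ++ fv ψ
fv (¬ᶠ φ) = fv φ
fv (∀ᶠ x φ) = removeV x (fv φ)
fv (pred n k ys) = toList ys
fv (□ᶠ φ) = fv φ

Closed : Fm → Set
Closed φ = fv φ ≡ []

fresh : List Var → Var
fresh xs = suc (foldr _⊔_ 0 xs)

update : (Var → Var) → Var → Var → (Var → Var)
update ρ z w v = if v ≡ᵇ z then w else ρ v

-- Capture-avoiding simultaneous renaming of free variables
-- (a bound variable is renamed only when it would capture).

rename : (Var → Var) → Fm → Fm
rename ρ ⊤ᶠ = ⊤ᶠ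
rename ρ ⊥ᶠ = ⊥ᶠ
rename ρ (φ ∧ᶠ ψ) = rename ρ φ ∧ᶠ rename ρ ψ
rename ρ (¬ᶠ φ) = ¬ᶠ rename ρ φ
rename ρ (∀ᶠ z φ) =
  let im = map ρ (fv (∀ᶠ z φ))
      w  = if elem z im then fresh im else z
  in ∀ᶠ w (rename (update ρ z w) φ)
rename ρ (pred n k ys) = pred n k (Vec.map ρ ys)
rename ρ (□ᶠ φ) = □ᶠ (rename ρ φ)

-- [y/x]φ : substitute y for the free occurrences of x in φ
sub : Var → Var → Fm → Fm
sub y x φ = rename (update (λ v → v) x y) φ

-- The n-ary predicate symbol P^n_k is replaced by the formula body n k,
-- whose argument places are the distinct variables args n k:
--   s(P^n_k(y₁,…,yₙ)) = body n k [y₁,…,yₙ / z₁,…,zₙ]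
-- (capture of parameters of the substituted formulas is avoided).

record USub : Set where
  field
    args     : (n k : ℕ) → Vec Var n
    body     : (n k : ℕ) → Fm
    distinct : (n k : ℕ) → Unique (toList (args n k))
open USub public

argMap : ∀ {n} → Vec Var n → Vec Var n → Var → Var
argMap Vec.[] Vec.[] v = v
argMap (z Vec.∷ zs) (y Vec.∷ ys) v = if v ≡ᵇ z then y else argMap zs ys v

preds : Fm → List (ℕ × ℕ)
preds ⊤ᶠ = []
preds ⊥ᶠ = []
preds (φ ∧ᶠ ψ) = preds φ ++ preds ψ
preds (¬ᶠ φ) = preds φ
preds (∀ᶠ x φ) = preds φ
preds (pred n k ys) = (n , k) ∷ []
preds (□ᶠ φ) = preds φ

params : USub → ℕ × ℕ → List Var
params σ (n , k) = removeAll (toList (args σ n k)) (fv (body σ n k))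

usubρ : USub → (Var → Var) → Fm → Fm
usubρ σ ρ ⊤ᶠ = ⊤ᶠ
usubρ σ ρ ⊥ᶠ = ⊥ᶠ
usubρ σ ρ (φ ∧ᶠ ψ) = usubρ σ ρ φ ∧ᶠ usubρ σ ρ ψ
usubρ σ ρ (¬ᶠ φ) = ¬ᶠ usubρ σ ρ φ
usubρ σ ρ (∀ᶠ z φ) =
  let avoid = map ρ (fv (∀ᶠ z φ)) ++ concatMap (params σ) (preds φ)
      w     = if elem z avoid then fresh avoid else z
  in ∀ᶠ w (usubρ σ (update ρ z w) φ)
usubρ σ ρ (pred n k ys) = rename (argMap (args σ n k) (Vec.map ρ ys)) (body σ n k)
usubρ σ ρ (□ᶠ φ) = □ᶠ (usubρ σ ρ φ)

usub : USub → Fm → Fm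
usub σ φ = usubρ σ (λ v → v) φ

-- Classical predicate tautologies: theorems of a standard Hilbert
-- calculus for classical first-order logic (without equality) over the
-- whole modal language (formulas □φ are treated as atoms).

data Taut : Fm → Set where
  ax1 : ∀ φ ψ → Taut (φ ⊃ᶠ (ψ ⊃ᶠ φ))
  ax2 : ∀ φ ψ χ → Taut ((φ ⊃ᶠ (ψ ⊃ᶠ χ)) ⊃ᶠ ((φ ⊃ᶠ ψ) ⊃ᶠ (φ ⊃ᶠ χ)))
  ax3 : ∀ φ ψ → Taut ((¬ᶠ φ ⊃ᶠ ¬ᶠ ψ) ⊃ᶠ (ψ ⊃ᶠ φ))
  ax4 : ∀ φ ψ → Taut (φ ∧ᶠ ψ ⊃ᶠ φ)
  ax5 : ∀ φ ψ → Taut (φ ∧ᶠ ψ ⊃ᶠ ψ)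
  ax6 : ∀ φ ψ → Taut (φ ⊃ᶠ (ψ ⊃ᶠ φ ∧ᶠ ψ))
  ax⊤ : Taut ⊤ᶠ
  ax⊥ : Taut (¬ᶠ ⊥ᶠ)
  q1  : ∀ x y φ → Taut (∀ᶠ x φ ⊃ᶠ sub y x φ)
  q2  : ∀ x φ ψ → elem x (fv φ) ≡ false →
        Taut (∀ᶠ x (φ ⊃ᶠ ψ) ⊃ᶠ (φ ⊃ᶠ ∀ᶠ x ψ))
  t-mp  : ∀ {φ ψ} → Taut φ → Taut (φ ⊃ᶠ ψ) → Taut ψ
  t-gen : ∀ {φ} x → Taut φ → Taut (∀ᶠ x φ)

record IsPML (L : Fm → Set) : Set where
  field
    taut   : ∀ φ → Taut φ → L φ
    mp     : ∀ φ ψ → L φ → L (φ ⊃ᶠ ψ) → L ψ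
    usubst : ∀ (σ : USub) φ → L φ → L (usub σ φ)
    gen    : ∀ x φ → L φ → L (∀ᶠ x φ)
    congr  : ∀ φ ψ → L (φ ≡ᶠ ψ) → L (□ᶠ φ ≡ᶠ □ᶠ ψ)

p q : Fm
p = pred 0 0 Vec.[]
q = pred 0 1 Vec.[]

MT TP CF : (Fm → Set) → Set
MT L = L (□ᶠ (p ∧ᶠ q) ⊃ᶠ □ᶠ p ∧ᶠ □ᶠ q)
TP L = L (□ᶠ ⊤ᶠ)
CF L = L (□ᶠ p ∧ᶠ □ᶠ q ⊃ᶠ □ᶠ (p ∧ᶠ q))

record Pair : Set where
  field
    α   : Fm
    β   : ℕ → Fm
    α-closed : Closed α
    β-closed : ∀ i → Closed (β i)
open Pair public

Admits : (Fm → Set) → Pair → Set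
Admits L P =
  ∀ (σ : USub) →
    (∀ i → L (usub σ (α P ⊃ᶠ β P i)))
  × (∀ φ → (∀ i → L (φ ⊃ᶠ usub σ (β P i))) → L (φ ⊃ᶠ usub σ (α P)))

-- The Lindenbaum algebra A(L), presented as the setoid of formulas
-- modulo  φ ≈ ψ  ⇔  φ ≡ ψ ∈ L  (so [φ] = [ψ] iff φ ≈L ψ).

module _ (L : Fm → Set) where

  _≈L_ : Fm → Fm → Set
  φ ≈L ψ = L (φ ≡ᶠ ψ)

  _≤L_ : Fm → Fm → Set
  φ ≤L ψ = (φ ∧ᶠ ψ) ≈L φ

  IsMeetL : {I : Set} → (I → Fm) → Fm → Set
  IsMeetL {I} f m = (∀ i → m ≤L f i) × (∀ φ → (∀ i → φ ≤L f i) → φ ≤L m)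

  IsModalAlgebraL : Set
  IsModalAlgebraL =
    LS.IsBooleanAlgebra _≈L_ _∨ᶠ_ _∧ᶠ_ ¬ᶠ_ ⊤ᶠ ⊥ᶠ
    × (∀ φ ψ → φ ≈L ψ → □ᶠ φ ≈L □ᶠ ψ)

  MTalg TPalg CFalg : Set
  MTalg = ∀ φ ψ → □ᶠ (φ ∧ᶠ ψ) ≤L (□ᶠ φ ∧ᶠ □ᶠ ψ)
  TPalg = □ᶠ ⊤ᶠ ≈L ⊤ᶠ
  CFalg = ∀ φ ψ → (□ᶠ φ ∧ᶠ □ᶠ ψ) ≤L □ᶠ (φ ∧ᶠ ψ)

-- A(L) is a Boolean algebra because every classical tautology built from
-- ∧, ¬, ⊤, ⊥ is a theorem of L; this is Kalmár's completeness argument for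
-- the Hilbert calculus, applied to tautologies in at most four atoms.  In
-- the Boolean order [φ] ≤ [ψ] holds exactly when φ ⊃ ψ ∈ L, so the meet
-- conditions are the axiom schemata (lower bound) and the ω-rule (greatest
-- lower bound) of each pair.  For ∀ the lower bounds are instances of
-- ∀x φ ⊃ [y/x]φ; conversely, if ψ ⊃ [y/x]φ ∈ L for all y, take y fresh for
-- ψ and φ, generalise over y, and α-rename ∀y [y/x]φ back to ∀x φ.
-- MT, TP and CF transfer by substituting arbitrary formulas for p and q.
module Submission where

open import Defs
open import Data.Bool using (Bool; true; false; T; _∧_; not)
open import Data.Bool.Properties using (T-∧; T-≡)
open import Data.Empty using (⊥-elim)
open import Data.Fin using (Fin; zero; suc)
open import Data.List using (List; []; _∷_; _++_; map; foldr; downFrom)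
open import Data.List.Membership.Propositional using (_∈_; _∉_)
open import Data.List.Membership.Propositional.Properties using (∈-++⁺ˡ; ∈-++⁺ʳ; ∈-++⁻; ∈-map⁻)
open import Data.List.Relation.Unary.Any as Any using (here; there)
open import Data.List.Relation.Unary.Any.Properties using (any⁻)
open import Data.List.Relation.Unary.Unique.Propositional using (Unique)
open import Data.List.Relation.Unary.Unique.Propositional.Properties using (downFrom⁺)
open import Data.Nat using (ℕ; zero; suc; _≡ᵇ_; _⊔_; _≤_; s≤s)
open import Data.Nat.Properties using (≡ᵇ⇒≡; ≡⇒≡ᵇ; m≤m⊔n; m≤n⊔m; ≤-trans; <-irrefl)
open import Data.Product using (∃; _×_; _,_; proj₁; proj₂; map₁)
open import Data.Sum using (inj₁; inj₂)
open import Data.Vec as Vec using (Vec; []; _∷_; lookup; toList)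
open import Data.Vec.Properties using (toList-map; map-cong; map-id)
open import Function using (_∘_; Equivalence)
open import Relation.Binary.PropositionalEquality
  using (_≡_; _≢_; refl; sym; trans; cong; cong₂; subst; subst₂; module ≡-Reasoning)
open import Relation.Nullary.Reflects using (Reflects; ofʸ; ofⁿ; fromEquivalence)
import Algebra.Lattice.Structures as LS

infix  2 _⊢_
infixl 5 _∙_

data _⊢_ (Γ : List Fm) : Fm → Set where
  hyp : ∀ {φ} → φ ∈ Γ → Γ ⊢ φ
  ax  : ∀ {φ} → Taut φ → Γ ⊢ φ
  _∙_ : ∀ {φ ψ} → Γ ⊢ φ ⊃ᶠ ψ → Γ ⊢ φ → Γ ⊢ ψ

hyp₀ : ∀ {Γ φ} → φ ∷ Γ ⊢ φ
hyp₀ = hyp (here refl)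

hyp₁ : ∀ {Γ φ ψ} → ψ ∷ φ ∷ Γ ⊢ φ
hyp₁ = hyp (there (here refl))

hyp₂ : ∀ {Γ φ ψ χ} → χ ∷ ψ ∷ φ ∷ Γ ⊢ φ
hyp₂ = hyp (there (there (here refl)))

taut-refl : ∀ φ → Taut (φ ⊃ᶠ φ)
taut-refl φ = t-mp (ax1 φ φ) (t-mp (ax1 φ (φ ⊃ᶠ φ)) (ax2 φ (φ ⊃ᶠ φ) φ))

deduction : ∀ {Γ φ ψ} → φ ∷ Γ ⊢ ψ → Γ ⊢ φ ⊃ᶠ ψ
deduction {φ = φ} (hyp (here refl))   = ax (taut-refl φ)
deduction {φ = φ} (hyp {ψ} (there m)) = ax (ax1 ψ φ) ∙ hyp m
deduction {φ = φ} (ax {ψ} t)          = ax (ax1 ψ φ) ∙ ax t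
deduction {φ = φ} (_∙_ {χ} {ψ} d e)   = ax (ax2 φ χ ψ) ∙ deduction d ∙ deduction e

[]⊢⇒Taut : ∀ {φ} → [] ⊢ φ → Taut φ
[]⊢⇒Taut (ax t)  = t
[]⊢⇒Taut (d ∙ e) = t-mp ([]⊢⇒Taut e) ([]⊢⇒Taut d)

taut-explosion : ∀ φ ψ → Taut (¬ᶠ φ ⊃ᶠ φ ⊃ᶠ ψ)
taut-explosion φ ψ = []⊢⇒Taut (deduction (ax (ax3 ψ φ) ∙ (ax (ax1 (¬ᶠ φ) (¬ᶠ ψ)) ∙ hyp₀)))

taut-¬¬-elim : ∀ φ → Taut (¬ᶠ ¬ᶠ φ ⊃ᶠ φ)
taut-¬¬-elim φ = []⊢⇒Taut (deduction
  (ax (ax3 φ (¬ᶠ ¬ᶠ φ))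
    ∙ (ax (ax3 (¬ᶠ ¬ᶠ ¬ᶠ φ) (¬ᶠ φ)) ∙ (ax (ax1 (¬ᶠ ¬ᶠ φ) (¬ᶠ ¬ᶠ ¬ᶠ ¬ᶠ φ)) ∙ hyp₀))
    ∙ hyp₀))

taut-¬¬-intro : ∀ φ → Taut (φ ⊃ᶠ ¬ᶠ ¬ᶠ φ)
taut-¬¬-intro φ = t-mp (taut-¬¬-elim (¬ᶠ φ)) (ax3 (¬ᶠ ¬ᶠ φ) φ)

taut-contraposition : ∀ φ ψ → Taut ((φ ⊃ᶠ ψ) ⊃ᶠ ¬ᶠ ψ ⊃ᶠ ¬ᶠ φ)
taut-contraposition φ ψ = []⊢⇒Taut (deduction
  (ax (ax3 (¬ᶠ φ) (¬ᶠ ψ)) ∙ deduction (ax (taut-¬¬-intro ψ) ∙ (hyp₁ ∙ (ax (taut-¬¬-elim φ) ∙ hyp₀)))))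

taut-cases : ∀ φ χ → Taut ((φ ⊃ᶠ χ) ⊃ᶠ (¬ᶠ φ ⊃ᶠ χ) ⊃ᶠ χ)
taut-cases φ χ = []⊢⇒Taut (deduction (deduction
  (ax (ax3 χ ⊤ᶠ)
    ∙ deduction (ax (taut-explosion (¬ᶠ φ) (¬ᶠ ⊤ᶠ))
                   ∙ (ax (taut-contraposition (¬ᶠ φ) χ) ∙ hyp₁ ∙ hyp₀)
                   ∙ (ax (taut-contraposition φ χ) ∙ hyp₂ ∙ hyp₀))
    ∙ ax ax⊤)))

-- Kalmár's lemma: propositional tautologies are derivable

infixr 6 _∧ᵖ_
infixr 5 _∨ᵖ_
infixr 4 _⊃ᵖ_
infix  3 _≡ᵖ_

data PForm (n : ℕ) : Set where
  atom    : Fin n → PForm n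
  ⊤ᵖ ⊥ᵖ   : PForm n
  _∧ᵖ_    : PForm n → PForm n → PForm n
  ¬ᵖ_     : PForm n → PForm n

_∨ᵖ_ _⊃ᵖ_ _≡ᵖ_ : ∀ {n} → PForm n → PForm n → PForm n
a ∨ᵖ b = ¬ᵖ (¬ᵖ a ∧ᵖ ¬ᵖ b)
a ⊃ᵖ b = ¬ᵖ (a ∧ᵖ ¬ᵖ b)
a ≡ᵖ b = (a ⊃ᵖ b) ∧ᵖ (b ⊃ᵖ a)

x₀ : ∀ {n} → PForm (suc n)
x₀ = atom zero

x₁ : ∀ {n} → PForm (suc (suc n))
x₁ = atom (suc zero)

x₂ : ∀ {n} → PForm (suc (suc (suc n)))
x₂ = atom (suc (suc zero))

x₃ : ∀ {n} → PForm (suc (suc (suc (suc n))))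
x₃ = atom (suc (suc (suc zero)))

⟦_⟧ : ∀ {n} → PForm n → Vec Fm n → Fm
⟦ atom i ⟧ ρ = lookup ρ i
⟦ ⊤ᵖ ⟧     ρ = ⊤ᶠ
⟦ ⊥ᵖ ⟧     ρ = ⊥ᶠ
⟦ a ∧ᵖ b ⟧ ρ = ⟦ a ⟧ ρ ∧ᶠ ⟦ b ⟧ ρ
⟦ ¬ᵖ a ⟧   ρ = ¬ᶠ ⟦ a ⟧ ρ

eval : ∀ {n} → PForm n → Vec Bool n → Bool
eval (atom i) v = lookup v i
eval ⊤ᵖ       v = true
eval ⊥ᵖ       v = false
eval (a ∧ᵖ b) v = eval a v ∧ eval b v
eval (¬ᵖ a)   v = not (eval a v)

literal : Bool → Fm → Fm
literal true  φ = φ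
literal false φ = ¬ᶠ φ

literals : ∀ {n} → Vec Fm n → Vec Bool n → List Fm
literals []      []      = []
literals (φ ∷ ρ) (b ∷ v) = literal b φ ∷ literals ρ v

literal∈literals : ∀ {n} (ρ : Vec Fm n) v i → literal (lookup v i) (lookup ρ i) ∈ literals ρ v
literal∈literals (φ ∷ ρ) (b ∷ v) zero    = here refl
literal∈literals (φ ∷ ρ) (b ∷ v) (suc i) = there (literal∈literals ρ v i)

kalmar : ∀ {n} (a : PForm n) ρ v → literals ρ v ⊢ literal (eval a v) (⟦ a ⟧ ρ)
kalmar (atom i) ρ v = hyp (literal∈literals ρ v i)
kalmar ⊤ᵖ       ρ v = ax ax⊤
kalmar ⊥ᵖ       ρ v = ax ax⊥
kalmar (a ∧ᵖ b) ρ v with eval a v | eval b v | kalmar a ρ v | kalmar b ρ v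
... | true  | true  | ⊢a | ⊢b = ax (ax6 _ _) ∙ ⊢a ∙ ⊢b
... | true  | false | ⊢a | ⊢b = ax (taut-contraposition _ _) ∙ ax (ax5 (⟦ a ⟧ ρ) (⟦ b ⟧ ρ)) ∙ ⊢b
... | false | _     | ⊢a | ⊢b = ax (taut-contraposition _ _) ∙ ax (ax4 (⟦ a ⟧ ρ) (⟦ b ⟧ ρ)) ∙ ⊢a
kalmar (¬ᵖ a)   ρ v with eval a v | kalmar a ρ v
... | true  | ⊢a = ax (taut-¬¬-intro _) ∙ ⊢a
... | false | ⊢a = ⊢a

literals-elim : ∀ {n} (ρ : Vec Fm n) {χ} → (∀ v → literals ρ v ⊢ χ) → [] ⊢ χ
literals-elim []      d = d []
literals-elim (φ ∷ ρ) {χ} d =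
  ax (taut-cases φ χ) ∙ literals-elim ρ (λ v → deduction (d (true ∷ v)))
                      ∙ literals-elim ρ (λ v → deduction (d (false ∷ v)))

allValuations : (n : ℕ) → (Vec Bool n → Bool) → Bool
allValuations zero    f = f []
allValuations (suc n) f = allValuations n (f ∘ (true ∷_)) ∧ allValuations n (f ∘ (false ∷_))

allValuations-sound : ∀ n f → T (allValuations n f) → ∀ v → T (f v)
allValuations-sound zero    f t []          = t
allValuations-sound (suc n) f t (true ∷ v)  = allValuations-sound n _ (proj₁ (Equivalence.to T-∧ t)) v
allValuations-sound (suc n) f t (false ∷ v) = allValuations-sound n _ (proj₂ (Equivalence.to T-∧ t)) v

isTautology : ∀ {n} → PForm n → Bool
isTautology {n} a = allValuations n (eval a)

tautology : ∀ {n} (a : PForm n) → T (isTautology a) → ∀ ρ → Taut (⟦ a ⟧ ρ)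
tautology {n} a t ρ = []⊢⇒Taut (literals-elim ρ λ v → true-literal (allValuations-sound n (eval a) t v) (kalmar a ρ v))
  where
  true-literal : ∀ {b Γ φ} → T b → Γ ⊢ literal b φ → Γ ⊢ φ
  true-literal {true} _ d = d

-- Renaming of variables

≡ᵇ-reflects : ∀ u v → Reflects (u ≡ v) (u ≡ᵇ v)
≡ᵇ-reflects u v = fromEquivalence (≡ᵇ⇒≡ u v) (≡⇒≡ᵇ u v)

update-≡ : ∀ ρ z w → update ρ z w z ≡ w
update-≡ ρ z w with z ≡ᵇ z | ≡ᵇ-reflects z z
... | true  | _        = refl
... | false | ofⁿ z≢z = ⊥-elim (z≢z refl)

update-≢ : ∀ ρ {z} w {v} → v ≢ z → update ρ z w v ≡ ρ v
update-≢ ρ {z} w {v} v≢z with v ≡ᵇ z | ≡ᵇ-reflects v z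
... | true  | ofʸ v≡z = ⊥-elim (v≢z v≡z)
... | false | _        = refl

∈-removeV⁻ : ∀ {u} z xs → u ∈ removeV z xs → u ∈ xs × u ≢ z
∈-removeV⁻ z (x ∷ xs) u∈ with x ≡ᵇ z | ≡ᵇ-reflects x z
... | true  | _ = map₁ there (∈-removeV⁻ z xs u∈)
∈-removeV⁻ z (x ∷ xs) (here refl) | false | ofⁿ x≢z = here refl , x≢z
∈-removeV⁻ z (x ∷ xs) (there u∈)  | false | _        = map₁ there (∈-removeV⁻ z xs u∈)

∈-removeV⁺ : ∀ {u} z xs → u ∈ xs → u ≢ z → u ∈ removeV z xs
∈-removeV⁺ z (x ∷ xs) u∈ u≢z with x ≡ᵇ z | ≡ᵇ-reflects x z
∈-removeV⁺ z (x ∷ xs) (here refl) u≢z | true  | ofʸ x≡z = ⊥-elim (u≢z x≡z)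
∈-removeV⁺ z (x ∷ xs) (there u∈)  u≢z | true  | _       = ∈-removeV⁺ z xs u∈ u≢z
∈-removeV⁺ z (x ∷ xs) (here refl) u≢z | false | _       = here refl
∈-removeV⁺ z (x ∷ xs) (there u∈)  u≢z | false | _       = there (∈-removeV⁺ z xs u∈ u≢z)

∉⇒elem≡false : ∀ {v} xs → v ∉ xs → elem v xs ≡ false
∉⇒elem≡false {v} xs v∉ with elem v xs in eq
... | true  = ⊥-elim (v∉ (Any.map (λ {u} t → sym (≡ᵇ⇒≡ u v t)) (any⁻ _ xs (Equivalence.from T-≡ eq))))
... | false = refl

fresh-∉ : ∀ xs → fresh xs ∉ xs
fresh-∉ xs v∈ = <-irrefl refl (s≤s (≤-max xs v∈))
  where
  ≤-max : ∀ {u} xs → u ∈ xs → u ≤ foldr _⊔_ 0 xs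
  ≤-max (x ∷ xs) (here refl) = m≤m⊔n x _
  ≤-max (x ∷ xs) (there u∈)  = ≤-trans (≤-max xs u∈) (m≤n⊔m x _)

vars : Fm → List Var
vars ⊤ᶠ            = []
vars ⊥ᶠ            = []
vars (φ ∧ᶠ ψ)      = vars φ ++ vars ψ
vars (¬ᶠ φ)        = vars φ
vars (∀ᶠ x φ)      = x ∷ vars φ
vars (pred n k ys) = toList ys
vars (□ᶠ φ)        = vars φ

fv⊆vars : ∀ {u} φ → u ∈ fv φ → u ∈ vars φ
fv⊆vars (φ ∧ᶠ ψ) u∈ with ∈-++⁻ (fv φ) u∈
... | inj₁ u∈φ = ∈-++⁺ˡ (fv⊆vars φ u∈φ)
... | inj₂ u∈ψ = ∈-++⁺ʳ (vars φ) (fv⊆vars ψ u∈ψ)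
fv⊆vars (¬ᶠ φ)        u∈ = fv⊆vars φ u∈
fv⊆vars (∀ᶠ x φ)      u∈ = there (fv⊆vars φ (proj₁ (∈-removeV⁻ x (fv φ) u∈)))
fv⊆vars (pred n k ys) u∈ = u∈
fv⊆vars (□ᶠ φ)        u∈ = fv⊆vars φ u∈

naiveRename : (Var → Var) → Fm → Fm
naiveRename ρ ⊤ᶠ            = ⊤ᶠ
naiveRename ρ ⊥ᶠ            = ⊥ᶠ
naiveRename ρ (φ ∧ᶠ ψ)      = naiveRename ρ φ ∧ᶠ naiveRename ρ ψ
naiveRename ρ (¬ᶠ φ)        = ¬ᶠ naiveRename ρ φ
naiveRename ρ (∀ᶠ z φ)      = ∀ᶠ z (naiveRename (update ρ z z) φ)
naiveRename ρ (pred n k ys) = pred n k (Vec.map ρ ys)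
naiveRename ρ (□ᶠ φ)        = □ᶠ (naiveRename ρ φ)

fv-naiveRename⁻ : ∀ ρ {u} φ → u ∈ fv (naiveRename ρ φ) → ∃ λ v → v ∈ fv φ × u ≡ ρ v
fv-naiveRename⁻ ρ (φ ∧ᶠ ψ) u∈ with ∈-++⁻ (fv (naiveRename ρ φ)) u∈
... | inj₁ u∈φ = let (v , v∈ , u≡) = fv-naiveRename⁻ ρ φ u∈φ in v , ∈-++⁺ˡ v∈ , u≡
... | inj₂ u∈ψ = let (v , v∈ , u≡) = fv-naiveRename⁻ ρ ψ u∈ψ in v , ∈-++⁺ʳ (fv φ) v∈ , u≡
fv-naiveRename⁻ ρ (¬ᶠ φ) u∈ = fv-naiveRename⁻ ρ φ u∈
fv-naiveRename⁻ ρ (∀ᶠ z φ) u∈ with ∈-removeV⁻ z (fv (naiveRename (update ρ z z) φ)) u∈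
... | u∈φ , u≢z with fv-naiveRename⁻ (update ρ z z) φ u∈φ
... | v , v∈ , u≡ with v ≡ᵇ z | ≡ᵇ-reflects v z
... | true  | _        = ⊥-elim (u≢z u≡)
... | false | ofⁿ v≢z = v , ∈-removeV⁺ z (fv φ) v∈ v≢z , u≡
fv-naiveRename⁻ ρ (pred n k ys) u∈ = ∈-map⁻ ρ (subst (_ ∈_) (toList-map ρ ys) u∈)
fv-naiveRename⁻ ρ (□ᶠ φ) u∈ = fv-naiveRename⁻ ρ φ u∈

NoCapture : (Var → Var) → List Var → Set
NoCapture ρ W = ∀ v z → v ∈ W → z ∈ W → v ≢ z → ρ v ≢ z

NoCapture-⊆ : ∀ {ρ W W′} → (∀ {u} → u ∈ W′ → u ∈ W) → NoCapture ρ W → NoCapture ρ W′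
NoCapture-⊆ W′⊆W nc v z v∈ z∈ = nc v z (W′⊆W v∈) (W′⊆W z∈)

NoCapture-update : ∀ ρ z W → NoCapture ρ (z ∷ W) → NoCapture (update ρ z z) W
NoCapture-update ρ z W nc v z′ v∈ z′∈ v≢z′ with v ≡ᵇ z | ≡ᵇ-reflects v z
... | true  | ofʸ refl = v≢z′
... | false | _        = nc v z′ (there v∈) (there z′∈) v≢z′

-- the capture test in `rename` fails, so the binder z is kept
binder-not-captured : ∀ ρ z φ → (∀ u → u ∈ fv φ → u ≢ z → ρ u ≢ z) →
                      elem z (map ρ (fv (∀ᶠ z φ))) ≡ false
binder-not-captured ρ z φ keep = ∉⇒elem≡false _ λ z∈ →
  let (u , u∈ , z≡ρu) = ∈-map⁻ ρ z∈
      (u∈φ , u≢z)     = ∈-removeV⁻ z (fv φ) u∈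
  in keep u u∈φ u≢z (sym z≡ρu)

rename≡naiveRename : ∀ ρ φ → NoCapture ρ (vars φ) → rename ρ φ ≡ naiveRename ρ φ
rename≡naiveRename ρ ⊤ᶠ nc = refl
rename≡naiveRename ρ ⊥ᶠ nc = refl
rename≡naiveRename ρ (φ ∧ᶠ ψ) nc =
  cong₂ _∧ᶠ_ (rename≡naiveRename ρ φ (NoCapture-⊆ ∈-++⁺ˡ nc))
             (rename≡naiveRename ρ ψ (NoCapture-⊆ (∈-++⁺ʳ (vars φ)) nc))
rename≡naiveRename ρ (¬ᶠ φ) nc = cong ¬ᶠ_ (rename≡naiveRename ρ φ nc)
rename≡naiveRename ρ (∀ᶠ z φ) nc
  rewrite binder-not-captured ρ z φ (λ u u∈ → nc u z (there (fv⊆vars φ u∈)) (here refl)) =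
  cong (∀ᶠ z) (rename≡naiveRename (update ρ z z) φ (NoCapture-update ρ z (vars φ) nc))
rename≡naiveRename ρ (pred n k ys) nc = refl
rename≡naiveRename ρ (□ᶠ φ) nc = cong □ᶠ (rename≡naiveRename ρ φ nc)

LeftInverseOn : (Var → Var) → (Var → Var) → List Var → Set
LeftInverseOn σ ρ W = ∀ v → v ∈ W → σ (ρ v) ≡ v

LeftInverseOn-update : ∀ σ ρ z W → LeftInverseOn σ ρ (z ∷ W) → NoCapture ρ (z ∷ W) →
                       LeftInverseOn (update σ z z) (update ρ z z) W
LeftInverseOn-update σ ρ z W inv nc v v∈ with v ≡ᵇ z | ≡ᵇ-reflects v z
... | true  | ofʸ refl = update-≡ σ v v
... | false | ofⁿ v≢z  =
  trans (update-≢ σ z (nc v z (there v∈) (here refl) v≢z)) (inv v (there v∈))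

map-LeftInverseOn : ∀ σ ρ {n} (ys : Vec Var n) → LeftInverseOn σ ρ (toList ys) →
                    Vec.map σ (Vec.map ρ ys) ≡ ys
map-LeftInverseOn σ ρ []       inv = refl
map-LeftInverseOn σ ρ (y ∷ ys) inv =
  cong₂ _∷_ (inv y (here refl)) (map-LeftInverseOn σ ρ ys (λ v v∈ → inv v (there v∈)))

binder-kept-by-inverse : ∀ σ ρ z φ → LeftInverseOn σ ρ (vars (∀ᶠ z φ)) →
                         ∀ u → u ∈ fv (naiveRename (update ρ z z) φ) → u ≢ z → σ u ≢ z
binder-kept-by-inverse σ ρ z φ inv u u∈ u≢z σu≡z with fv-naiveRename⁻ (update ρ z z) φ u∈
... | v , v∈ , u≡ with v ≡ᵇ z | ≡ᵇ-reflects v z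
... | true  | _        = u≢z u≡
... | false | ofⁿ v≢z = v≢z (trans (sym (inv v (there (fv⊆vars φ v∈)))) (trans (cong σ (sym u≡)) σu≡z))

rename-naiveRename-inverse : ∀ σ ρ φ → LeftInverseOn σ ρ (vars φ) → NoCapture ρ (vars φ) →
                             rename σ (naiveRename ρ φ) ≡ φ
rename-naiveRename-inverse σ ρ ⊤ᶠ inv nc = refl
rename-naiveRename-inverse σ ρ ⊥ᶠ inv nc = refl
rename-naiveRename-inverse σ ρ (φ ∧ᶠ ψ) inv nc =
  cong₂ _∧ᶠ_ (rename-naiveRename-inverse σ ρ φ (λ v v∈ → inv v (∈-++⁺ˡ v∈)) (NoCapture-⊆ ∈-++⁺ˡ nc))
             (rename-naiveRename-inverse σ ρ ψ (λ v v∈ → inv v (∈-++⁺ʳ (vars φ) v∈))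
                                             (NoCapture-⊆ (∈-++⁺ʳ (vars φ)) nc))
rename-naiveRename-inverse σ ρ (¬ᶠ φ) inv nc = cong ¬ᶠ_ (rename-naiveRename-inverse σ ρ φ inv nc)
rename-naiveRename-inverse σ ρ (∀ᶠ z φ) inv nc
  rewrite binder-not-captured σ z (naiveRename (update ρ z z) φ) (binder-kept-by-inverse σ ρ z φ inv) =
  cong (∀ᶠ z) (rename-naiveRename-inverse (update σ z z) (update ρ z z) φ
                 (LeftInverseOn-update σ ρ z (vars φ) inv nc) (NoCapture-update ρ z (vars φ) nc))
rename-naiveRename-inverse σ ρ (pred n k ys) inv nc = cong (pred n k) (map-LeftInverseOn σ ρ ys inv)
rename-naiveRename-inverse σ ρ (□ᶠ φ) inv nc = cong □ᶠ (rename-naiveRename-inverse σ ρ φ inv nc)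

rename-id : ∀ {ρ} → (∀ v → ρ v ≡ v) → ∀ φ → rename ρ φ ≡ φ
rename-id ρ≗id ⊤ᶠ = refl
rename-id ρ≗id ⊥ᶠ = refl
rename-id ρ≗id (φ ∧ᶠ ψ) = cong₂ _∧ᶠ_ (rename-id ρ≗id φ) (rename-id ρ≗id ψ)
rename-id ρ≗id (¬ᶠ φ) = cong ¬ᶠ_ (rename-id ρ≗id φ)
rename-id {ρ} ρ≗id (∀ᶠ z φ)
  rewrite binder-not-captured ρ z φ (λ u _ u≢z ρu≡z → u≢z (trans (sym (ρ≗id u)) ρu≡z)) =
  cong (∀ᶠ z) (rename-id update≗id φ)
  where
  update≗id : ∀ v → update ρ z z v ≡ v
  update≗id v with v ≡ᵇ z | ≡ᵇ-reflects v z
  ... | true  | ofʸ v≡z = sym v≡z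
  ... | false | _        = ρ≗id v
rename-id ρ≗id (pred n k ys) = cong (pred n k) (trans (map-cong ρ≗id ys) (map-id ys))
rename-id ρ≗id (□ᶠ φ) = cong □ᶠ (rename-id ρ≗id φ)

-- α-renaming a bound variable to a fresh one

[_/_] : Var → Var → Var → Var
[ y / x ] = update (λ v → v) x y

NoCapture-fresh : ∀ x {y} W → y ∉ W → NoCapture [ y / x ] W
NoCapture-fresh x {y} W y∉ v z v∈ z∈ v≢z with v ≡ᵇ x | ≡ᵇ-reflects v x
... | true  | _ = λ y≡z → y∉ (subst (_∈ W) (sym y≡z) z∈)
... | false | _ = v≢z

sub≡naiveRename : ∀ x {y} φ → y ∉ vars φ → sub y x φ ≡ naiveRename [ y / x ] φ
sub≡naiveRename x φ y∉ = rename≡naiveRename [ _ / x ] φ (NoCapture-fresh x (vars φ) y∉)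

sub-sub-fresh : ∀ x {y} φ → y ∉ vars φ → sub x y (sub y x φ) ≡ φ
sub-sub-fresh x {y} φ y∉ = begin
  rename [ x / y ] (sub y x φ)                   ≡⟨ cong (rename [ x / y ]) (sub≡naiveRename x φ y∉) ⟩
  rename [ x / y ] (naiveRename [ y / x ] φ)     ≡⟨ rename-naiveRename-inverse [ x / y ] [ y / x ] φ
                                                      inverse (NoCapture-fresh x (vars φ) y∉) ⟩
  φ                                              ∎
  where
  open ≡-Reasoning
  inverse : LeftInverseOn [ x / y ] [ y / x ] (vars φ)
  inverse v v∈ with v ≡ᵇ x | ≡ᵇ-reflects v x
  ... | true  | ofʸ refl = update-≡ (λ u → u) y v
  ... | false | _        = update-≢ (λ u → u) x (λ v≡y → y∉ (subst (_∈ vars φ) v≡y v∈))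

∉-fv-∀-sub-fresh : ∀ x {y} φ → y ∉ vars φ → x ∉ fv (∀ᶠ y (sub y x φ))
∉-fv-∀-sub-fresh x {y} φ y∉ x∈ with ∈-removeV⁻ y (fv (sub y x φ)) x∈
... | x∈sub , x≢y with fv-naiveRename⁻ [ y / x ] φ (subst (λ ψ → x ∈ fv ψ) (sub≡naiveRename x φ y∉) x∈sub)
... | v , _ , x≡ with v ≡ᵇ x | ≡ᵇ-reflects v x
... | true  | _        = x≢y x≡
... | false | ofⁿ v≢x = v≢x (sym x≡)

taut-α-rename : ∀ x y φ → y ∉ vars φ → Taut (∀ᶠ y (sub y x φ) ⊃ᶠ ∀ᶠ x φ)
taut-α-rename x y φ y∉ =
  t-mp (t-gen x (subst (λ ψ → Taut (∀ᶠ y (sub y x φ) ⊃ᶠ ψ)) (sub-sub-fresh x φ y∉) (q1 y x (sub y x φ))))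
       (q2 x (∀ᶠ y (sub y x φ)) φ (∉⇒elem≡false _ (∉-fv-∀-sub-fresh x φ y∉)))

downFromᵛ : (n : ℕ) → Vec Var n
downFromᵛ zero    = []
downFromᵛ (suc n) = n ∷ downFromᵛ n

toList-downFromᵛ : ∀ n → toList (downFromᵛ n) ≡ downFrom n
toList-downFromᵛ zero    = refl
toList-downFromᵛ (suc n) = cong (n ∷_) (toList-downFromᵛ n)

[p,q≔_,_] : Fm → Fm → USub
[p,q≔ φ , ψ ] = record
  { args     = λ n k → downFromᵛ n
  ; body     = body′
  ; distinct = λ n k → subst Unique (sym (toList-downFromᵛ n)) (downFrom⁺ n)
  }
  where
  body′ : ℕ → ℕ → Fm
  body′ 0 0 = φ
  body′ 0 1 = ψ
  body′ _ _ = ⊤ᶠ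

usub-p : ∀ φ ψ → usub [p,q≔ φ , ψ ] p ≡ φ
usub-p φ ψ = rename-id (λ _ → refl) φ

usub-q : ∀ φ ψ → usub [p,q≔ φ , ψ ] q ≡ ψ
usub-q φ ψ = rename-id (λ _ → refl) ψ

-- The Lindenbaum algebra

module _ (L : Fm → Set) (isL : IsPML L) where
  open IsPML isL

  infixl 5 _⊙_

  _⊙_ : ∀ {φ ψ} → L (φ ⊃ᶠ ψ) → L φ → L ψ
  f ⊙ x = mp _ _ x f

  byTaut : ∀ {n} (a : PForm n) {_ : T (isTautology a)} (ρ : Vec Fm n) → L (⟦ a ⟧ ρ)
  byTaut a {t} ρ = taut _ (tautology a t ρ)

  ⊃⇒≤ : ∀ {φ ψ} → L (φ ⊃ᶠ ψ) → _≤L_ L φ ψ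
  ⊃⇒≤ {φ} {ψ} h = byTaut ((x₀ ⊃ᵖ x₁) ⊃ᵖ (x₀ ∧ᵖ x₁ ≡ᵖ x₀)) (φ ∷ ψ ∷ []) ⊙ h

  ≤⇒⊃ : ∀ {φ ψ} → _≤L_ L φ ψ → L (φ ⊃ᶠ ψ)
  ≤⇒⊃ {φ} {ψ} h = byTaut ((x₀ ∧ᵖ x₁ ≡ᵖ x₀) ⊃ᵖ (x₀ ⊃ᵖ x₁)) (φ ∷ ψ ∷ []) ⊙ h

  ⊃-trans : ∀ {φ ψ χ} → L (φ ⊃ᶠ ψ) → L (ψ ⊃ᶠ χ) → L (φ ⊃ᶠ χ)
  ⊃-trans {φ} {ψ} {χ} h k = byTaut ((x₀ ⊃ᵖ x₁) ⊃ᵖ (x₁ ⊃ᵖ x₂) ⊃ᵖ (x₀ ⊃ᵖ x₂)) (φ ∷ ψ ∷ χ ∷ []) ⊙ h ⊙ k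

  isBooleanAlgebra : LS.IsBooleanAlgebra (_≈L_ L) _∨ᶠ_ _∧ᶠ_ ¬ᶠ_ ⊤ᶠ ⊥ᶠ
  isBooleanAlgebra = record
    { isDistributiveLattice = record
      { isLattice = record
        { isEquivalence = record
          { refl  = λ {φ} → byTaut (x₀ ≡ᵖ x₀) (φ ∷ [])
          ; sym   = λ {φ} {ψ} h → byTaut ((x₀ ≡ᵖ x₁) ⊃ᵖ (x₁ ≡ᵖ x₀)) (φ ∷ ψ ∷ []) ⊙ h
          ; trans = λ {φ} {ψ} {χ} h k →
              byTaut ((x₀ ≡ᵖ x₁) ⊃ᵖ (x₁ ≡ᵖ x₂) ⊃ᵖ (x₀ ≡ᵖ x₂)) (φ ∷ ψ ∷ χ ∷ []) ⊙ h ⊙ k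
          }
        ; ∨-comm     = λ φ ψ → byTaut (x₀ ∨ᵖ x₁ ≡ᵖ x₁ ∨ᵖ x₀) (φ ∷ ψ ∷ [])
        ; ∨-assoc    = λ φ ψ χ → byTaut ((x₀ ∨ᵖ x₁) ∨ᵖ x₂ ≡ᵖ x₀ ∨ᵖ (x₁ ∨ᵖ x₂)) (φ ∷ ψ ∷ χ ∷ [])
        ; ∨-cong     = λ {φ} {ψ} {χ} {θ} h k →
            byTaut ((x₀ ≡ᵖ x₁) ⊃ᵖ (x₂ ≡ᵖ x₃) ⊃ᵖ (x₀ ∨ᵖ x₂ ≡ᵖ x₁ ∨ᵖ x₃)) (φ ∷ ψ ∷ χ ∷ θ ∷ []) ⊙ h ⊙ k
        ; ∧-comm     = λ φ ψ → byTaut (x₀ ∧ᵖ x₁ ≡ᵖ x₁ ∧ᵖ x₀) (φ ∷ ψ ∷ [])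
        ; ∧-assoc    = λ φ ψ χ → byTaut ((x₀ ∧ᵖ x₁) ∧ᵖ x₂ ≡ᵖ x₀ ∧ᵖ (x₁ ∧ᵖ x₂)) (φ ∷ ψ ∷ χ ∷ [])
        ; ∧-cong     = λ {φ} {ψ} {χ} {θ} h k →
            byTaut ((x₀ ≡ᵖ x₁) ⊃ᵖ (x₂ ≡ᵖ x₃) ⊃ᵖ (x₀ ∧ᵖ x₂ ≡ᵖ x₁ ∧ᵖ x₃)) (φ ∷ ψ ∷ χ ∷ θ ∷ []) ⊙ h ⊙ k
        ; absorptive = (λ φ ψ → byTaut (x₀ ∨ᵖ (x₀ ∧ᵖ x₁) ≡ᵖ x₀) (φ ∷ ψ ∷ []))
                     , (λ φ ψ → byTaut (x₀ ∧ᵖ (x₀ ∨ᵖ x₁) ≡ᵖ x₀) (φ ∷ ψ ∷ []))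
        }
      ; ∨-distrib-∧ = (λ φ ψ χ → byTaut (x₀ ∨ᵖ (x₁ ∧ᵖ x₂) ≡ᵖ (x₀ ∨ᵖ x₁) ∧ᵖ (x₀ ∨ᵖ x₂)) (φ ∷ ψ ∷ χ ∷ []))
                    , (λ φ ψ χ → byTaut ((x₁ ∧ᵖ x₂) ∨ᵖ x₀ ≡ᵖ (x₁ ∨ᵖ x₀) ∧ᵖ (x₂ ∨ᵖ x₀)) (φ ∷ ψ ∷ χ ∷ []))
      ; ∧-distrib-∨ = (λ φ ψ χ → byTaut (x₀ ∧ᵖ (x₁ ∨ᵖ x₂) ≡ᵖ (x₀ ∧ᵖ x₁) ∨ᵖ (x₀ ∧ᵖ x₂)) (φ ∷ ψ ∷ χ ∷ []))
                    , (λ φ ψ χ → byTaut ((x₁ ∨ᵖ x₂) ∧ᵖ x₀ ≡ᵖ (x₁ ∧ᵖ x₀) ∨ᵖ (x₂ ∧ᵖ x₀)) (φ ∷ ψ ∷ χ ∷ []))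
      }
    ; ∨-complement = (λ φ → byTaut (¬ᵖ x₀ ∨ᵖ x₀ ≡ᵖ ⊤ᵖ) (φ ∷ []))
                   , (λ φ → byTaut (x₀ ∨ᵖ ¬ᵖ x₀ ≡ᵖ ⊤ᵖ) (φ ∷ []))
    ; ∧-complement = (λ φ → byTaut (¬ᵖ x₀ ∧ᵖ x₀ ≡ᵖ ⊥ᵖ) (φ ∷ []))
                   , (λ φ → byTaut (x₀ ∧ᵖ ¬ᵖ x₀ ≡ᵖ ⊥ᵖ) (φ ∷ []))
    ; ¬-cong = λ {φ} {ψ} h → byTaut ((x₀ ≡ᵖ x₁) ⊃ᵖ (¬ᵖ x₀ ≡ᵖ ¬ᵖ x₁)) (φ ∷ ψ ∷ []) ⊙ h
    }

  admits⇒isMeet : ∀ P → Admits L P → ∀ σ → IsMeetL L (λ i → usub σ (β P i)) (usub σ (α P))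
  admits⇒isMeet P admits σ =
      (λ i → ⊃⇒≤ (proj₁ (admits σ) i))
    , (λ φ lower → ⊃⇒≤ (proj₂ (admits σ) φ (λ i → ≤⇒⊃ (lower i))))

  ∀-intro : ∀ ψ x φ → (∀ y → L (ψ ⊃ᶠ sub y x φ)) → L (ψ ⊃ᶠ ∀ᶠ x φ)
  ∀-intro ψ x φ h =
    ⊃-trans (taut _ (q2 y ψ (sub y x φ) (∉⇒elem≡false (fv ψ) y∉ψ)) ⊙ gen y _ (h y))
            (taut _ (taut-α-rename x y φ y∉φ))
    where
    y = fresh (vars φ ++ fv ψ)
    y∉φ : y ∉ vars φ
    y∉φ = fresh-∉ (vars φ ++ fv ψ) ∘ ∈-++⁺ˡ
    y∉ψ : y ∉ fv ψ
    y∉ψ = fresh-∉ (vars φ ++ fv ψ) ∘ ∈-++⁺ʳ (vars φ)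

  ∀-isMeet : ∀ φ x → IsMeetL L {Var} (λ y → sub y x φ) (∀ᶠ x φ)
  ∀-isMeet φ x =
      (λ y → ⊃⇒≤ (taut _ (q1 x y φ)))
    , (λ ψ lower → ⊃⇒≤ (∀-intro ψ x φ (λ y → ≤⇒⊃ (lower y))))

  MT⇒MTalg : MT L → MTalg L
  MT⇒MTalg mt φ ψ = ⊃⇒≤ (subst₂ (λ φ′ ψ′ → L (□ᶠ (φ′ ∧ᶠ ψ′) ⊃ᶠ □ᶠ φ′ ∧ᶠ □ᶠ ψ′))
                                (usub-p φ ψ) (usub-q φ ψ) (usubst [p,q≔ φ , ψ ] _ mt))

  TP⇒TPalg : TP L → TPalg L
  TP⇒TPalg tp = byTaut (x₀ ⊃ᵖ (x₀ ≡ᵖ ⊤ᵖ)) (□ᶠ ⊤ᶠ ∷ []) ⊙ tp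

  CF⇒CFalg : CF L → CFalg L
  CF⇒CFalg cf φ ψ = ⊃⇒≤ (subst₂ (λ φ′ ψ′ → L (□ᶠ φ′ ∧ᶠ □ᶠ ψ′ ⊃ᶠ □ᶠ (φ′ ∧ᶠ ψ′)))
                                (usub-p φ ψ) (usub-q φ ψ) (usubst [p,q≔ φ , ψ ] _ cf))

lemma5p1 : (L : Fm → Set) → IsPML L →
           (pairs : ℕ → Pair) → (∀ j → Admits L (pairs j)) →
           IsModalAlgebraL L
           × (∀ j (σ : USub) →
                IsMeetL L (λ i → usub σ (β (pairs j) i)) (usub σ (α (pairs j))))
           × (∀ φ x → IsMeetL L {Var} (λ y → sub y x φ) (∀ᶠ x φ))
           × (MT L → MTalg L)
           × (TP L → TPalg L)
           × (CF L → CFalg L)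
lemma5p1 L isL pairs admits =
    (isBooleanAlgebra L isL , IsPML.congr isL)
  , (λ j → admits⇒isMeet L isL (pairs j) (admits j))
  , ∀-isMeet L isL
  , MT⇒MTalg L isL
  , TP⇒TPalg L isL
  , CF⇒CFalg L isL
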